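{- Let $S$ be a complete cap in $\Sigma=\mathrm{PG}(n,2)$, let $H_\infty$ be a subspace of codimension $2$ with $S\cap H_\infty=\emptyset$, and let $K_C$ be one of the three hyperplanes containing $H_\infty$, with $|S\cap K_C|=2$. Then there exist a hyperplane $\Sigma'\cong\mathrm{PG}(n-1,2)$ of $\Sigma$ and a point $v\in\Sigma\setminus\Sigma'$ such that $S'=S\cap\Sigma'$ is a complete cap in $\Sigma'$ and $S=\phi(S')=S'\sqcup\{v+x: x\in S'\}$ (the Plotkin double of $S'$ from the vertex $v$). In particular, $|S|=2^{n-1}+2$.
   Context: Points of $\mathrm{PG}(n,2)$ are the nonzero vectors of $\mathbb{F}_2^{n+1}$; three distinct points $x,y,z$ are collinear iff $x+y=z$. A cap is a set with no three collinear points; complete if not properly contained in another cap of the ambient space. For a subset $X$ of a hyperplane $\Sigma'$ and a point $v\notin\Sigma'$, the Plotkin double of $X$ from $v$ is $\phi(X)=X\sqcup\{v+x:x\in X\}$. -}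

module Defs where

open import Data.Bool using (Bool; true; false; _xor_; _∧_; not; if_then_else_)
open import Data.Nat using (ℕ; zero; suc; _+_)
open import Data.List using (List; []; _∷_; map; _++_)
open import Data.Nat.ListAction using (sum)
open import Data.Vec using (Vec; []; _∷_; zipWith; replicate; foldr)
open import Data.Product using (_×_)
open import Relation.Binary.PropositionalEquality using (_≡_; _≢_)

-- Vectors of F₂^m, with F₂ = Bool (addition = xor, multiplication = ∧).
V : ℕ → Set
V m = Vec Bool m

_⊕_ : ∀ {m} → V m → V m → V m
x ⊕ y = zipWith _xor_ x y

infixl 6 _⊕_

𝟎 : ∀ {m} → V m
𝟎 = replicate _ false

dot : ∀ {m} → V m → V m → Bool
dot x y = foldr _ _xor_ false (zipWith _∧_ x y)

-- points of PG(n,2) are nonzero vectors of F₂^{n+1}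
IsPoint : ∀ {m} → V m → Set
IsPoint x = x ≢ 𝟎

Hyp : ∀ {m} → V m → V m → Set
Hyp c x = IsPoint x × dot c x ≡ false

Subset : ℕ → Set
Subset m = V m → Bool

-- a cap inside the ambient point set A: contained in A, no three distinct
-- collinear points (x, y distinct in S ⇒ x + y ∉ S)
IsCap : ∀ {m} → (V m → Set) → Subset m → Set
IsCap A S =
  (∀ x → S x ≡ true → A x) ×
  (∀ x y → S x ≡ true → S y ≡ true → x ≢ y → S (x ⊕ y) ≡ false)

IsCompleteCap : ∀ {m} → (V m → Set) → Subset m → Set
IsCompleteCap A S =
  IsCap A S ×
  (∀ (T : Subset _) → IsCap A T → (∀ x → S x ≡ true → T x ≡ true) →
     ∀ x → T x ≡ true → S x ≡ true)

allVecs : (m : ℕ) → List (V m)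
allVecs zero = [] ∷ []
allVecs (suc m) = map (false ∷_) (allVecs m) ++ map (true ∷_) (allVecs m)

card : ∀ {m} → Subset m → ℕ
card {m} S = sum (map (λ x → if S x then 1 else 0) (allVecs m))

-- Let S ∩ K_C = {p, q} and v = p + q.  A point x off K_C that is not in S lies,
-- by completeness, on a secant y + z of S; since c·y + c·z = c·x = 1, one of y, z
-- is in K_C, so x + p or x + q lies in S.  Together with the cap property this makes
-- S invariant under translation by v, and makes translation by p exchange S and
-- its complement off K_C.  Invariance under v turns S into the Plotkin double of its
-- section by any hyperplane Σ′ missing v, and the exchange gives
-- |S ∖ K_C| = |PG(n,2) ∖ K_C| / 2 = 2^(n-1).

module Submission where

open import Defs
open import Algebra.Bundles using (CommutativeRing)
open import Data.Bool using (Bool; true; false; _∧_; _∨_; not; _xor_; if_then_else_; T?)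
open import Data.Bool.Properties
  using (xor-comm; xor-assoc; xor-identityʳ; xor-same; xor-∧-commutativeRing; ∧-distribˡ-xor;
         ∧-comm; ∧-zeroʳ; ∧-conicalˡ; ∧-conicalʳ; not-injective; not-involutive; ¬-not; T-≡; ∨-zeroʳ)
  renaming (_≟_ to _≟ᵇ_)
open import Data.Nat using (ℕ; zero; suc; _+_; _*_; _∸_; _^_)
open import Data.Nat.Properties using (+-commutativeSemigroup; +-comm; +-identityʳ; *-cancelˡ-≡; m*n≡1⇒m≡1)
open import Data.Nat.ListAction using (sum)
open import Data.Nat.ListAction.Properties using (sum-++)
open import Data.List using (List; []; _∷_; map; _++_; length; filterᵇ)
open import Data.List.Properties using (map-++; map-∘; map-cong)
open import Data.List.Membership.Propositional using (_∈_)
open import Data.List.Membership.Propositional.Properties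
  using (∈-map⁺; ∈-map⁻; ∈-++⁺ˡ; ∈-++⁺ʳ; ∈-filter⁺; ∈-filter⁻)
open import Data.List.Relation.Unary.Any using (here; there)
open import Data.List.Relation.Unary.AllPairs using ([]; _∷_)
open import Data.List.Relation.Unary.All using ([]; _∷_)
open import Data.List.Relation.Unary.Unique.Propositional using (Unique)
import Data.List.Relation.Unary.Unique.Propositional.Properties as Unique
open import Data.Vec using ([]; _∷_)
open import Data.Vec.Properties using (≡-dec)
open import Data.Vec.Relation.Binary.Pointwise.Inductive
  using (Pointwise-≡⇒≡; zipWith-comm; zipWith-assoc; zipWith-identityʳ)
open import Data.Product using (Σ; _×_; ∃; _,_; proj₁; proj₂)
open import Data.Sum using (_⊎_; inj₁; inj₂)
open import Data.Empty using (⊥; ⊥-elim)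
open import Function using (_∘_; Equivalence)
open import Relation.Nullary using (does; yes)
open import Relation.Nullary.Decidable using (dec-true; dec-false)
open import Relation.Binary.Definitions using (DecidableEquality)
open import Relation.Binary.PropositionalEquality
open ≡-Reasoning

open CommutativeRing xor-∧-commutativeRing
  using () renaming (+-commutativeSemigroup to xor-commutativeSemigroup)
open import Algebra.Properties.CommutativeSemigroup xor-commutativeSemigroup
  using () renaming (interchange to xor-interchange)
open import Algebra.Properties.CommutativeSemigroup +-commutativeSemigroup
  using () renaming (interchange to +-interchange)

⊕-comm : ∀ {m} (x y : V m) → x ⊕ y ≡ y ⊕ x
⊕-comm x y = Pointwise-≡⇒≡ (zipWith-comm xor-comm x y)

⊕-assoc : ∀ {m} (x y z : V m) → (x ⊕ y) ⊕ z ≡ x ⊕ (y ⊕ z)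
⊕-assoc x y z = Pointwise-≡⇒≡ (zipWith-assoc xor-assoc x y z)

⊕-identityʳ : ∀ {m} (x : V m) → x ⊕ 𝟎 ≡ x
⊕-identityʳ x = Pointwise-≡⇒≡ (zipWith-identityʳ xor-identityʳ x)

⊕-self : ∀ {m} (x : V m) → x ⊕ x ≡ 𝟎
⊕-self [] = refl
⊕-self (a ∷ x) = cong₂ _∷_ (xor-same a) (⊕-self x)

⊕-cancelʳ : ∀ {m} (x y : V m) → (x ⊕ y) ⊕ y ≡ x
⊕-cancelʳ x y = begin
  (x ⊕ y) ⊕ y  ≡⟨ ⊕-assoc x y y ⟩
  x ⊕ (y ⊕ y)  ≡⟨ cong (x ⊕_) (⊕-self y) ⟩
  x ⊕ 𝟎        ≡⟨ ⊕-identityʳ x ⟩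
  x            ∎

⊕-cancelˡ : ∀ {m} (x y : V m) → x ⊕ (x ⊕ y) ≡ y
⊕-cancelˡ x y = begin
  x ⊕ (x ⊕ y)  ≡⟨ cong (x ⊕_) (⊕-comm x y) ⟩
  x ⊕ (y ⊕ x)  ≡⟨ ⊕-assoc x y x ⟨
  (x ⊕ y) ⊕ x  ≡⟨ cong (_⊕ x) (⊕-comm x y) ⟩
  (y ⊕ x) ⊕ x  ≡⟨ ⊕-cancelʳ y x ⟩
  y            ∎

⊕-cancel-both : ∀ {m} (x y u : V m) → (x ⊕ u) ⊕ (y ⊕ u) ≡ x ⊕ y
⊕-cancel-both x y u = begin
  (x ⊕ u) ⊕ (y ⊕ u)  ≡⟨ ⊕-assoc x u (y ⊕ u) ⟩
  x ⊕ (u ⊕ (y ⊕ u))  ≡⟨ cong (λ w → x ⊕ (u ⊕ w)) (⊕-comm y u) ⟩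
  x ⊕ (u ⊕ (u ⊕ y))  ≡⟨ cong (x ⊕_) (⊕-cancelˡ u y) ⟩
  x ⊕ y              ∎

x⊕y≡z⇒y≡x⊕z : ∀ {m} {x y z : V m} → x ⊕ y ≡ z → y ≡ x ⊕ z
x⊕y≡z⇒y≡x⊕z {x = x} {y} refl = sym (⊕-cancelˡ x y)

x⊕y≡z⇒x≡z⊕y : ∀ {m} {x y z : V m} → x ⊕ y ≡ z → x ≡ z ⊕ y
x⊕y≡z⇒x≡z⊕y {x = x} {y} refl = sym (⊕-cancelʳ x y)

x⊕y≡𝟎⇒x≡y : ∀ {m} {x y : V m} → x ⊕ y ≡ 𝟎 → x ≡ y
x⊕y≡𝟎⇒x≡y {x = x} e = sym (trans (x⊕y≡z⇒y≡x⊕z e) (⊕-identityʳ x))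

x⊕y≡y⇒x≡𝟎 : ∀ {m} {x y : V m} → x ⊕ y ≡ y → x ≡ 𝟎
x⊕y≡y⇒x≡𝟎 {y = y} e = trans (x⊕y≡z⇒x≡z⊕y e) (⊕-self y)

dot-⊕ʳ : ∀ {m} (c x y : V m) → dot c (x ⊕ y) ≡ dot c x xor dot c y
dot-⊕ʳ [] [] [] = refl
dot-⊕ʳ (c ∷ cs) (x ∷ xs) (y ∷ ys) = begin
  (c ∧ (x xor y)) xor dot cs (xs ⊕ ys)
    ≡⟨ cong₂ _xor_ (∧-distribˡ-xor c x y) (dot-⊕ʳ cs xs ys) ⟩
  ((c ∧ x) xor (c ∧ y)) xor (dot cs xs xor dot cs ys)
    ≡⟨ xor-interchange (c ∧ x) (c ∧ y) (dot cs xs) (dot cs ys) ⟩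
  ((c ∧ x) xor dot cs xs) xor ((c ∧ y) xor dot cs ys)
    ∎

dot-comm : ∀ {m} (x y : V m) → dot x y ≡ dot y x
dot-comm [] [] = refl
dot-comm (a ∷ x) (b ∷ y) = cong₂ _xor_ (∧-comm a b) (dot-comm x y)

dot-zeroˡ : ∀ {m} (x : V m) → dot 𝟎 x ≡ false
dot-zeroˡ [] = refl
dot-zeroˡ (a ∷ x) = dot-zeroˡ x

dot-zeroʳ : ∀ {m} (c : V m) → dot c 𝟎 ≡ false
dot-zeroʳ [] = refl
dot-zeroʳ (a ∷ c) = trans (cong (_xor dot c 𝟎) (∧-zeroʳ a)) (dot-zeroʳ c)

dot≡true⇒≢𝟎 : ∀ {m} {c x : V m} → dot c x ≡ true → x ≢ 𝟎
dot≡true⇒≢𝟎 {c = c} e refl with trans (sym e) (dot-zeroʳ c)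
... | ()

nonzero⇒∃dot≡true : ∀ {m} {c : V m} → c ≢ 𝟎 → ∃ λ u → dot c u ≡ true
nonzero⇒∃dot≡true {c = []} c≢𝟎 = ⊥-elim (c≢𝟎 refl)
nonzero⇒∃dot≡true {c = true ∷ c} _ = true ∷ 𝟎 , cong (true xor_) (dot-zeroʳ c)
nonzero⇒∃dot≡true {c = false ∷ c} c≢𝟎 with nonzero⇒∃dot≡true {c = c} (c≢𝟎 ∘ cong (false ∷_))
... | u , e = false ∷ u , e

∃hyperplane-avoiding : ∀ {m} {v : V m} → v ≢ 𝟎 → ∃ λ c′ → c′ ≢ 𝟎 × dot c′ v ≡ true
∃hyperplane-avoiding {v = v} v≢𝟎 with nonzero⇒∃dot≡true v≢𝟎
... | c′ , vc′ = c′ , c′≢𝟎 , c′v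
  where
  c′v : dot c′ v ≡ true
  c′v = trans (dot-comm c′ v) vc′
  c′≢𝟎 : c′ ≢ 𝟎
  c′≢𝟎 refl with trans (sym c′v) (dot-zeroˡ v)
  ... | ()

xor≡false⇒≡ : ∀ {a b} → a xor b ≡ false → a ≡ b
xor≡false⇒≡ {false} {false} _ = refl
xor≡false⇒≡ {true} {true} _ = refl

true≢false : true ≢ false
true≢false ()

sumVecs : ∀ {m} → (V m → ℕ) → ℕ
sumVecs {m} h = sum (map h (allVecs m))

sumVecs-cong : ∀ {m} {h k : V m → ℕ} → (∀ x → h x ≡ k x) → sumVecs h ≡ sumVecs k
sumVecs-cong {m} e = cong sum (map-cong e (allVecs m))

sum-map-+ : ∀ {A : Set} (h k : A → ℕ) (xs : List A) →
  sum (map (λ x → h x + k x) xs) ≡ sum (map h xs) + sum (map k xs)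
sum-map-+ h k [] = refl
sum-map-+ h k (x ∷ xs) = begin
  (h x + k x) + sum (map (λ x → h x + k x) xs)        ≡⟨ cong ((h x + k x) +_) (sum-map-+ h k xs) ⟩
  (h x + k x) + (sum (map h xs) + sum (map k xs))     ≡⟨ +-interchange (h x) (k x) _ _ ⟩
  (h x + sum (map h xs)) + (k x + sum (map k xs))     ∎

sumVecs-+ : ∀ {m} (h k : V m → ℕ) → sumVecs (λ x → h x + k x) ≡ sumVecs h + sumVecs k
sumVecs-+ {m} h k = sum-map-+ h k (allVecs m)

sumVecs-∷ : ∀ {m} (h : V (suc m) → ℕ) →
  sumVecs h ≡ sumVecs (h ∘ (false ∷_)) + sumVecs (h ∘ (true ∷_))
sumVecs-∷ {m} h = begin
  sum (map h (map (false ∷_) xs ++ map (true ∷_) xs))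
    ≡⟨ cong sum (map-++ h (map (false ∷_) xs) (map (true ∷_) xs)) ⟩
  sum (map h (map (false ∷_) xs) ++ map h (map (true ∷_) xs))
    ≡⟨ sum-++ (map h (map (false ∷_) xs)) _ ⟩
  sum (map h (map (false ∷_) xs)) + sum (map h (map (true ∷_) xs))
    ≡⟨ cong₂ _+_ (cong sum (map-∘ xs)) (cong sum (map-∘ xs)) ⟨
  sumVecs (h ∘ (false ∷_)) + sumVecs (h ∘ (true ∷_))
    ∎
  where
  xs : List (V m)
  xs = allVecs m

sumVecs-⊕ : ∀ {m} (h : V m → ℕ) (u : V m) → sumVecs (λ x → h (x ⊕ u)) ≡ sumVecs h
sumVecs-⊕ {zero} h [] = refl
sumVecs-⊕ {suc m} h (false ∷ u) = begin
  sumVecs (λ x → h (x ⊕ (false ∷ u)))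
    ≡⟨ sumVecs-∷ (λ x → h (x ⊕ (false ∷ u))) ⟩
  sumVecs (λ x → h (false ∷ x ⊕ u)) + sumVecs (λ x → h (true ∷ x ⊕ u))
    ≡⟨ cong₂ _+_ (sumVecs-⊕ (h ∘ (false ∷_)) u) (sumVecs-⊕ (h ∘ (true ∷_)) u) ⟩
  sumVecs (h ∘ (false ∷_)) + sumVecs (h ∘ (true ∷_))
    ≡⟨ sumVecs-∷ h ⟨
  sumVecs h
    ∎
sumVecs-⊕ {suc m} h (true ∷ u) = begin
  sumVecs (λ x → h (x ⊕ (true ∷ u)))
    ≡⟨ sumVecs-∷ (λ x → h (x ⊕ (true ∷ u))) ⟩
  sumVecs (λ x → h (true ∷ x ⊕ u)) + sumVecs (λ x → h (false ∷ x ⊕ u))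
    ≡⟨ cong₂ _+_ (sumVecs-⊕ (h ∘ (true ∷_)) u) (sumVecs-⊕ (h ∘ (false ∷_)) u) ⟩
  sumVecs (h ∘ (true ∷_)) + sumVecs (h ∘ (false ∷_))
    ≡⟨ +-comm (sumVecs (h ∘ (true ∷_))) _ ⟩
  sumVecs (h ∘ (false ∷_)) + sumVecs (h ∘ (true ∷_))
    ≡⟨ sumVecs-∷ h ⟨
  sumVecs h
    ∎

card-cong : ∀ {m} {f g : Subset m} → (∀ x → f x ≡ g x) → card f ≡ card g
card-cong e = sumVecs-cong (λ x → cong (if_then 1 else 0) (e x))

card-⊕ : ∀ {m} (f : Subset m) (u : V m) → card (λ x → f (x ⊕ u)) ≡ card f
card-⊕ f = sumVecs-⊕ (λ x → if f x then 1 else 0)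

card-split : ∀ {m} (f g : Subset m) →
  card f ≡ card (λ x → f x ∧ g x) + card (λ x → f x ∧ not (g x))
card-split {m} f g = trans (sumVecs-cong (λ x → split (f x) (g x)))
  (sumVecs-+ {m} (λ x → if f x ∧ g x then 1 else 0) (λ x → if f x ∧ not (g x) then 1 else 0))
  where
  split : ∀ a b → (if a then 1 else 0) ≡ (if a ∧ b then 1 else 0) + (if a ∧ not b then 1 else 0)
  split false _ = refl
  split true false = refl
  split true true = refl

card-true : ∀ m → card {m} (λ _ → true) ≡ 2 ^ m
card-true zero = refl
card-true (suc m) = begin
  card {suc m} (λ _ → true)                    ≡⟨ sumVecs-∷ {m} (λ _ → 1) ⟩
  card {m} (λ _ → true) + card {m} (λ _ → true) ≡⟨ cong (λ k → k + k) (card-true m) ⟩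
  2 ^ m + 2 ^ m                                ≡⟨ cong (2 ^ m +_) (+-identityʳ (2 ^ m)) ⟨
  2 * 2 ^ m                                    ∎

card-halves : ∀ {m} (f g : Subset m) (u : V m) →
  (∀ x → f (x ⊕ u) ≡ f x) → (∀ x → f x ≡ true → g (x ⊕ u) ≡ not (g x)) →
  2 * card (λ x → f x ∧ g x) ≡ card f
card-halves f g u f-invariant g-flips = begin
  2 * k                                ≡⟨ cong (k +_) (+-identityʳ k) ⟩
  k + k                                ≡⟨ cong (k +_) complement≡k ⟨
  k + card (λ x → f x ∧ not (g x))     ≡⟨ card-split f g ⟨
  card f                               ∎
  where
  k : ℕ
  k = card (λ x → f x ∧ g x)
  translated : ∀ x → (f (x ⊕ u) ∧ not (g (x ⊕ u))) ≡ (f x ∧ g x)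
  translated x rewrite f-invariant x with f x in fx
  ... | false = refl
  ... | true = trans (cong not (g-flips x fx)) (not-involutive (g x))
  complement≡k : card (λ x → f x ∧ not (g x)) ≡ k
  complement≡k = trans (sym (card-⊕ (λ x → f x ∧ not (g x)) u)) (card-cong translated)

card-dot : ∀ {n} {c : V (suc n)} → c ≢ 𝟎 → card (dot c) ≡ 2 ^ n
card-dot {n} {c} c≢𝟎 with nonzero⇒∃dot≡true c≢𝟎
... | u , cu = *-cancelˡ-≡ (card (dot c)) (2 ^ n) 2
  (trans (card-halves (λ _ → true) (dot c) u (λ _ → refl) flips) (card-true (suc n)))
  where
  flips : ∀ x → true ≡ true → dot c (x ⊕ u) ≡ not (dot c x)
  flips x _ = begin
    dot c (x ⊕ u)          ≡⟨ dot-⊕ʳ c x u ⟩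
    dot c x xor dot c u    ≡⟨ cong (dot c x xor_) cu ⟩
    dot c x xor true       ≡⟨ xor-comm (dot c x) true ⟩
    not (dot c x)          ∎

half-of-power : ∀ n {k} → 2 * k ≡ 2 ^ n → k ≡ 2 ^ (n ∸ 1)
half-of-power zero {k} e with m*n≡1⇒m≡1 2 k e
... | ()
half-of-power (suc n) {k} e = *-cancelˡ-≡ k (2 ^ n) 2 e

card≡length-filter : ∀ {m} (f : Subset m) → card f ≡ length (filterᵇ f (allVecs m))
card≡length-filter {m} f = go (allVecs m)
  where
  go : (xs : List (V m)) → sum (map (λ x → if f x then 1 else 0) xs) ≡ length (filterᵇ f xs)
  go [] = refl
  go (x ∷ xs) with f x
  ... | true = cong suc (go xs)
  ... | false = go xs

∈-allVecs : ∀ {m} (x : V m) → x ∈ allVecs m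
∈-allVecs [] = here refl
∈-allVecs {suc m} (false ∷ x) = ∈-++⁺ˡ (∈-map⁺ (false ∷_) (∈-allVecs x))
∈-allVecs {suc m} (true ∷ x) = ∈-++⁺ʳ (map (false ∷_) (allVecs m)) (∈-map⁺ (true ∷_) (∈-allVecs x))

allVecs-unique : ∀ m → Unique (allVecs m)
allVecs-unique zero = [] ∷ []
allVecs-unique (suc m) =
  Unique.++⁺ (Unique.map⁺ ∷-injectiveʳ (allVecs-unique m))
             (Unique.map⁺ ∷-injectiveʳ (allVecs-unique m))
             disjoint
  where
  ∷-injectiveʳ : ∀ {b} {x y : V m} → b ∷ x ≡ b ∷ y → x ≡ y
  ∷-injectiveʳ refl = refl
  disjoint : ∀ {x} → x ∈ map (false ∷_) (allVecs m) × x ∈ map (true ∷_) (allVecs m) → ⊥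
  disjoint (x∈₀ , x∈₁) with ∈-map⁻ (false ∷_) x∈₀ | ∈-map⁻ (true ∷_) x∈₁
  ... | _ , _ , refl | _ , _ , ()

record ExactlyTwo {m} (f : Subset m) : Set where
  field
    fst snd : V m
    fst≢snd : fst ≢ snd
    fst∈ : f fst ≡ true
    snd∈ : f snd ≡ true
    ∈⇒fst⊎snd : ∀ x → f x ≡ true → x ≡ fst ⊎ x ≡ snd

card≡2⇒exactlyTwo : ∀ {m} (f : Subset m) → card f ≡ 2 → ExactlyTwo f
card≡2⇒exactlyTwo {m} f card≡2 with filterᵇ f (allVecs m) in eq | trans (sym (card≡length-filter f)) card≡2
... | p ∷ q ∷ [] | _ = record
  { fst = p ; snd = q
  ; fst≢snd = fst≢snd
  ; fst∈ = ∈f (here refl)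
  ; snd∈ = ∈f (there (here refl))
  ; ∈⇒fst⊎snd = λ x fx →
      ∈pq (subst (x ∈_) eq (∈-filter⁺ (T? ∘ f) (∈-allVecs x) (Equivalence.from T-≡ fx)))
  }
  where
  ∈f : ∀ {x} → x ∈ p ∷ q ∷ [] → f x ≡ true
  ∈f x∈ = Equivalence.to T-≡ (proj₂ (∈-filter⁻ (T? ∘ f) {xs = allVecs m} (subst (_ ∈_) (sym eq) x∈)))
  ∈pq : ∀ {x} → x ∈ p ∷ q ∷ [] → x ≡ p ⊎ x ≡ q
  ∈pq (here x≡p) = inj₁ x≡p
  ∈pq (there (here x≡q)) = inj₂ x≡q
  fst≢snd : p ≢ q
  fst≢snd with subst Unique eq (Unique.filter⁺ (T? ∘ f) (allVecs-unique m))
  ... | (p≢q ∷ []) ∷ _ = p≢q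

offSecants⇒∈ : ∀ {m} {S : Subset m} {y : V m} → IsCompleteCap IsPoint S → IsPoint y →
  (∀ x z → S x ≡ true → S z ≡ true → x ⊕ z ≢ y) → S y ≡ true
offSecants⇒∈ {m} {S} {y} ((S-points , S-cap) , S-maximal) y-point offSecants =
  S-maximal T (T-points , T-cap) (λ x Sx → cong (_∨ is-y x) Sx) y T-y
  where
  _≟_ : DecidableEquality (V m)
  _≟_ = ≡-dec _≟ᵇ_
  is-y : V m → Bool
  is-y x = does (x ≟ y)
  T : Subset m
  T x = S x ∨ is-y x
  T-y : T y ≡ true
  T-y = trans (cong (S y ∨_) (dec-true (y ≟ y) refl)) (∨-zeroʳ (S y))
  T-cases : ∀ {x} → T x ≡ true → S x ≡ true ⊎ x ≡ y
  T-cases {x} Tx with S x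
  ... | true = inj₁ refl
  ... | false with x ≟ y
  ...   | yes x≡y = inj₂ x≡y
  T-points : ∀ x → T x ≡ true → IsPoint x
  T-points x Tx with T-cases Tx
  ... | inj₁ Sx = S-points x Sx
  ... | inj₂ refl = y-point
  T-false : ∀ {w} → S w ≡ false → w ≢ y → T w ≡ false
  T-false Sw w≢y = cong₂ _∨_ Sw (dec-false (_ ≟ y) w≢y)
  T-⊕y : ∀ {x} → S x ≡ true → T (x ⊕ y) ≡ false
  T-⊕y {x} Sx = T-false (¬-not λ S[x⊕y] → offSecants x (x ⊕ y) Sx S[x⊕y] (⊕-cancelˡ x y))
                        (S-points x Sx ∘ x⊕y≡y⇒x≡𝟎)
  T-cap : ∀ x z → T x ≡ true → T z ≡ true → x ≢ z → T (x ⊕ z) ≡ false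
  T-cap x z Tx Tz x≢z with T-cases Tx | T-cases Tz
  ... | inj₁ Sx | inj₁ Sz = T-false (S-cap x z Sx Sz x≢z) (offSecants x z Sx Sz)
  ... | inj₁ Sx | inj₂ refl = T-⊕y Sx
  ... | inj₂ refl | inj₁ Sz = trans (cong T (⊕-comm y z)) (T-⊕y Sz)
  ... | inj₂ refl | inj₂ refl = ⊥-elim (x≢z refl)

module TranslationInvariantCap {m} {S : Subset m} (S-complete : IsCompleteCap IsPoint S)
  {v : V m} (S-⊕v : ∀ x → S x ≡ true → S (x ⊕ v) ≡ true)
  (c′ : V m) (c′v : dot c′ v ≡ true) where

  S′ : Subset m
  S′ x = S x ∧ not (dot c′ x)

  InDouble : V m → Set
  InDouble y = S′ y ≡ true ⊎ ∃ λ x → S′ x ≡ true × y ≡ v ⊕ x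

  private
    S-points : ∀ x → S x ≡ true → IsPoint x
    S-points = proj₁ (proj₁ S-complete)
    S-cap : ∀ x y → S x ≡ true → S y ≡ true → x ≢ y → S (x ⊕ y) ≡ false
    S-cap = proj₂ (proj₁ S-complete)

    S′⁻ : ∀ {x} → S′ x ≡ true → S x ≡ true × dot c′ x ≡ false
    S′⁻ S′x = ∧-conicalˡ _ _ S′x , not-injective (∧-conicalʳ _ _ S′x)

    S′⁺ : ∀ {x} → S x ≡ true → dot c′ x ≡ false → S′ x ≡ true
    S′⁺ Sx c′x = cong₂ (λ s d → s ∧ not d) Sx c′x

    dot-⊕v : ∀ x → dot c′ (x ⊕ v) ≡ not (dot c′ x)
    dot-⊕v x = trans (dot-⊕ʳ c′ x v) (trans (cong (dot c′ x xor_) c′v) (xor-comm (dot c′ x) true))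

    S-⊕v-S′ : ∀ {x} → S x ≡ true → dot c′ x ≡ true → S′ (x ⊕ v) ≡ true
    S-⊕v-S′ {x} Sx c′x = S′⁺ (S-⊕v x Sx) (trans (dot-⊕v x) (cong not c′x))

  S′-complete : IsCompleteCap (Hyp c′) S′
  S′-complete = (S′-points , S′-cap) , S′-maximal
    where
    S′-points : ∀ x → S′ x ≡ true → Hyp c′ x
    S′-points x S′x = S-points x (proj₁ (S′⁻ S′x)) , proj₂ (S′⁻ S′x)
    S′-cap : ∀ x y → S′ x ≡ true → S′ y ≡ true → x ≢ y → S′ (x ⊕ y) ≡ false
    S′-cap x y S′x S′y x≢y =
      cong (_∧ not (dot c′ (x ⊕ y))) (S-cap x y (proj₁ (S′⁻ S′x)) (proj₁ (S′⁻ S′y)) x≢y)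
    S′-maximal : ∀ T → IsCap (Hyp c′) T → (∀ x → S′ x ≡ true → T x ≡ true) →
                 ∀ x → T x ≡ true → S′ x ≡ true
    S′-maximal T (T-hyp , T-cap) S′⊆T x Tx = S′⁺ (offSecants⇒∈ S-complete x-point offSecants) c′x
      where
      x-point : IsPoint x
      x-point = proj₁ (T-hyp x Tx)
      c′x : dot c′ x ≡ false
      c′x = proj₂ (T-hyp x Tx)
      offSecants-S′ : ∀ y z → S′ y ≡ true → S′ z ≡ true → y ⊕ z ≢ x
      offSecants-S′ y z S′y S′z y⊕z≡x = true≢false (begin
        true       ≡⟨ Tx ⟨
        T x        ≡⟨ cong T y⊕z≡x ⟨
        T (y ⊕ z)  ≡⟨ T-cap y z (S′⊆T y S′y) (S′⊆T z S′z) y≢z ⟩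
        false      ∎)
        where
        y≢z : y ≢ z
        y≢z refl = x-point (trans (sym y⊕z≡x) (⊕-self y))
      same-side : ∀ {y z} → y ⊕ z ≡ x → dot c′ z ≡ dot c′ y
      same-side {y} {z} y⊕z≡x =
        sym (xor≡false⇒≡ (trans (sym (dot-⊕ʳ c′ y z)) (trans (cong (dot c′) y⊕z≡x) c′x)))
      offSecants : ∀ y z → S y ≡ true → S z ≡ true → y ⊕ z ≢ x
      offSecants y z Sy Sz y⊕z≡x with dot c′ y in c′y
      ... | false = offSecants-S′ y z (S′⁺ Sy c′y) (S′⁺ Sz (trans (same-side y⊕z≡x) c′y)) y⊕z≡x
      ... | true = offSecants-S′ (y ⊕ v) (z ⊕ v)
                     (S-⊕v-S′ Sy c′y) (S-⊕v-S′ Sz (trans (same-side y⊕z≡x) c′y))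
                     (trans (⊕-cancel-both y z v) y⊕z≡x)

  v⊕S′-disjoint : ∀ x → S′ x ≡ true → S′ (v ⊕ x) ≡ false
  v⊕S′-disjoint x S′x = trans (cong (λ d → S (v ⊕ x) ∧ not d) c′[v⊕x]) (∧-zeroʳ (S (v ⊕ x)))
    where
    c′[v⊕x] : dot c′ (v ⊕ x) ≡ true
    c′[v⊕x] = trans (cong (dot c′) (⊕-comm v x)) (trans (dot-⊕v x) (cong not (proj₂ (S′⁻ S′x))))

  S⊆double : ∀ y → S y ≡ true → InDouble y
  S⊆double y Sy = by-side (dot c′ y) refl
    where
    by-side : ∀ b → dot c′ y ≡ b → InDouble y
    by-side false c′y = inj₁ (S′⁺ Sy c′y)
    by-side true c′y = inj₂ (y ⊕ v , S-⊕v-S′ Sy c′y , sym (trans (⊕-comm v (y ⊕ v)) (⊕-cancelʳ y v)))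

  double⊆S : ∀ y → InDouble y → S y ≡ true
  double⊆S y (inj₁ S′y) = proj₁ (S′⁻ S′y)
  double⊆S y (inj₂ (x , S′x , refl)) =
    subst (λ w → S w ≡ true) (⊕-comm x v) (S-⊕v x (proj₁ (S′⁻ S′x)))

module HyperplaneMeetsInTwo {m} {S : Subset m} (S-complete : IsCompleteCap IsPoint S)
  (c : V m) (K : ExactlyTwo (λ x → S x ∧ not (dot c x))) where

  open ExactlyTwo K renaming (fst to p; snd to q; fst≢snd to p≢q)

  v : V m
  v = p ⊕ q

  private
    S-cap : ∀ x y → S x ≡ true → S y ≡ true → x ≢ y → S (x ⊕ y) ≡ false
    S-cap = proj₂ (proj₁ S-complete)

    S-p : S p ≡ true
    S-p = ∧-conicalˡ _ _ fst∈
    S-q : S q ≡ true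
    S-q = ∧-conicalˡ _ _ snd∈
    c-p : dot c p ≡ false
    c-p = not-injective (∧-conicalʳ _ _ fst∈)
    c-q : dot c q ≡ false
    c-q = not-injective (∧-conicalʳ _ _ snd∈)

    S∩ker : ∀ {x} → S x ≡ true → dot c x ≡ false → x ≡ p ⊎ x ≡ q
    S∩ker {x} Sx cx = ∈⇒fst⊎snd x (cong₂ (λ s d → s ∧ not d) Sx cx)

    dot-⊕ker : ∀ {x u} → dot c u ≡ false → dot c (x ⊕ u) ≡ dot c x
    dot-⊕ker {x} {u} cu = trans (dot-⊕ʳ c x u) (trans (cong (dot c x xor_) cu) (xor-identityʳ (dot c x)))

    c-v : dot c v ≡ false
    c-v = trans (dot-⊕ker c-q) c-p

    separated : ∀ {x y} → dot c x ≡ true → dot c y ≡ false → x ≢ y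
    separated cx cy refl = true≢false (trans (sym cx) cy)

    ⊕v⊕p : ∀ x → (x ⊕ v) ⊕ p ≡ x ⊕ q
    ⊕v⊕p x = trans (⊕-assoc x v p) (cong (x ⊕_) (trans (cong (_⊕ p) (⊕-comm p q)) (⊕-cancelʳ q p)))

    ⊕v⊕q : ∀ x → (x ⊕ v) ⊕ q ≡ x ⊕ p
    ⊕v⊕q x = trans (⊕-assoc x v q) (cong (x ⊕_) (⊕-cancelʳ p q))

    offKer⇒∈ : ∀ {x} → dot c x ≡ true → S (x ⊕ p) ≡ false → S (x ⊕ q) ≡ false → S x ≡ true
    offKer⇒∈ {x} cx S[x⊕p] S[x⊕q] = offSecants⇒∈ S-complete (dot≡true⇒≢𝟎 {c = c} cx) offSecants
      where
      partner : ∀ {y z} → S y ≡ true → dot c y ≡ false → S z ≡ true → y ⊕ z ≢ x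
      partner Sy cy Sz y⊕z≡x with S∩ker Sy cy | x⊕y≡z⇒y≡x⊕z y⊕z≡x
      ... | inj₁ refl | refl = true≢false (trans (sym Sz) (trans (cong S (⊕-comm p x)) S[x⊕p]))
      ... | inj₂ refl | refl = true≢false (trans (sym Sz) (trans (cong S (⊕-comm q x)) S[x⊕q]))
      offSecants : ∀ y z → S y ≡ true → S z ≡ true → y ⊕ z ≢ x
      offSecants y z Sy Sz y⊕z≡x with dot c y in cy
      ... | false = partner Sy cy Sz y⊕z≡x
      ... | true = partner Sz cz Sy (trans (⊕-comm z y) y⊕z≡x)
        where
        cz : dot c z ≡ false
        cz = not-injective (begin
          not (dot c z)          ≡⟨ cong (_xor dot c z) cy ⟨
          dot c y xor dot c z    ≡⟨ dot-⊕ʳ c y z ⟨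
          dot c (y ⊕ z)          ≡⟨ cong (dot c) y⊕z≡x ⟩
          dot c x                ≡⟨ cx ⟩
          true                   ∎)

  S-⊕v : ∀ x → S x ≡ true → S (x ⊕ v) ≡ true
  S-⊕v x Sx with dot c x in cx
  ... | false with S∩ker Sx cx
  ...   | inj₁ refl = subst (λ w → S w ≡ true) (sym (⊕-cancelˡ p q)) S-q
  ...   | inj₂ refl = subst (λ w → S w ≡ true) (sym (trans (⊕-comm q v) (⊕-cancelʳ p q))) S-p
  S-⊕v x Sx | true = offKer⇒∈ (trans (dot-⊕ker c-v) cx)
    (trans (cong S (⊕v⊕p x)) (S-cap x q Sx S-q (separated cx c-q)))
    (trans (cong S (⊕v⊕q x)) (S-cap x p Sx S-p (separated cx c-p)))

  private
    S-⊕v-false : ∀ x → S x ≡ false → S (x ⊕ v) ≡ false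
    S-⊕v-false x Sx = ¬-not λ S[x⊕v] →
      true≢false (trans (sym (S-⊕v (x ⊕ v) S[x⊕v])) (trans (cong S (⊕-cancelʳ x v)) Sx))

  S-⊕p : ∀ x → dot c x ≡ true → S (x ⊕ p) ≡ not (S x)
  S-⊕p x cx with S x in Sx
  ... | true = S-cap x p Sx S-p (separated cx c-p)
  ... | false = offKer⇒∈ (trans (dot-⊕ker c-p) cx)
    (trans (cong S (⊕-cancelʳ x p)) Sx)
    (trans (cong S (⊕-assoc x p q)) (S-⊕v-false x Sx))

  v≢𝟎 : v ≢ 𝟎
  v≢𝟎 = p≢q ∘ x⊕y≡𝟎⇒x≡y

  card-S∖ker : 2 * card (λ x → S x ∧ dot c x) ≡ card (dot c)
  card-S∖ker = begin
    2 * card (λ x → S x ∧ dot c x)   ≡⟨ cong (2 *_) (card-cong (λ x → ∧-comm (S x) (dot c x))) ⟩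
    2 * card (λ x → dot c x ∧ S x)   ≡⟨ card-halves (dot c) S p (λ x → dot-⊕ker c-p) S-⊕p ⟩
    card (dot c)                     ∎

lemma6p1 : (n : ℕ) (S : Subset (suc n)) → IsCompleteCap IsPoint S →
    (a b : V (suc n)) → a ≢ 𝟎 → b ≢ 𝟎 → a ≢ b →
    (∀ x → S x ≡ true → dot a x ≡ false → dot b x ≡ false → ⊥) →
    (c : V (suc n)) → c ≢ 𝟎 →
    (∀ x → IsPoint x → dot a x ≡ false → dot b x ≡ false → dot c x ≡ false) →
    card (λ x → S x ∧ not (dot c x)) ≡ 2 →
    Σ (V (suc n)) λ c′ → c′ ≢ 𝟎 × Σ (V (suc n)) λ v →
      IsPoint v × dot c′ v ≡ true ×
      IsCompleteCap (Hyp c′) (λ x → S x ∧ not (dot c′ x)) ×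
      (∀ x → (S x ∧ not (dot c′ x)) ≡ true → (S (v ⊕ x) ∧ not (dot c′ (v ⊕ x))) ≡ false) ×
      (∀ y → S y ≡ true →
        ((S y ∧ not (dot c′ y)) ≡ true ⊎
         ∃ λ x → (S x ∧ not (dot c′ x)) ≡ true × y ≡ v ⊕ x)) ×
      (∀ y → ((S y ∧ not (dot c′ y)) ≡ true ⊎
         ∃ λ x → (S x ∧ not (dot c′ x)) ≡ true × y ≡ v ⊕ x) → S y ≡ true) ×
      card S ≡ 2 ^ (n ∸ 1) + 2
lemma6p1 n S S-complete _ _ _ _ _ _ c c≢𝟎 _ card[S∩K] =
  c′ , c′≢𝟎 , v , v≢𝟎 , c′v , S′-complete , v⊕S′-disjoint , S⊆double , double⊆S , card-S
  where
  open HyperplaneMeetsInTwo S-complete c (card≡2⇒exactlyTwo _ card[S∩K])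
  Σ′ : ∃ λ c′ → c′ ≢ 𝟎 × dot c′ v ≡ true
  Σ′ = ∃hyperplane-avoiding v≢𝟎
  c′ : V (suc n)
  c′ = proj₁ Σ′
  c′≢𝟎 : c′ ≢ 𝟎
  c′≢𝟎 = proj₁ (proj₂ Σ′)
  c′v : dot c′ v ≡ true
  c′v = proj₂ (proj₂ Σ′)
  open TranslationInvariantCap S-complete S-⊕v c′ c′v
  card-S : card S ≡ 2 ^ (n ∸ 1) + 2
  card-S = begin
    card S                                                           ≡⟨ card-split S (dot c) ⟩
    card (λ x → S x ∧ dot c x) + card (λ x → S x ∧ not (dot c x))    ≡⟨ cong₂ _+_ half card[S∩K] ⟩
    2 ^ (n ∸ 1) + 2                                                  ∎
    where
    half : card (λ x → S x ∧ dot c x) ≡ 2 ^ (n ∸ 1)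
    half = half-of-power n (trans card-S∖ker (card-dot c≢𝟎))
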